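{- Let $M:\mathbb{Z}_{\ge0}^3\to\mathbb{Z}$ be a function with the triple Lucas property, and define $L(n,k)=\sum_{j=0}^n M(n,k,j)$ for $n,k\ge0$. Then $L$ satisfies the double Lucas congruences: for every prime $p$ and all $n,k\ge0$ with base-$p$ digits $n=\sum_{i=0}^r n_ip^i$, $k=\sum_{i=0}^r k_ip^i$, we have $L(n,k)\equiv L(n_0,k_0)\cdots L(n_r,k_r)\pmod p$. In particular, if moreover $L(n,k)=0$ for $k>n$, then $L$ has the double Lucas property.
   Context: A function $L:\mathbb{Z}_{\ge0}^2\to\mathbb{Z}$ has the double Lucas property if $L(n,k)=0$ whenever $k>n$, and for every prime $p$ and all $n,k\ge0$, writing $n=\sum_{i=0}^r n_ip^i$, $k=\sum_{i=0}^r k_ip^i$ with base-$p$ digits $0\le n_i,k_i<p$ (padded with zeros to a common length), $L(n,k)\equiv\prod_{i=0}^r L(n_i,k_i)\pmod p$. A function $M:\mathbb{Z}_{\ge0}^3\to\mathbb{Z}$ has the triple Lucas property if $M(n,k,j)=0$ whenever $j>n$, and for every prime $p$ and all $n,k,j\ge0$ with base-$p$ digits $n_i,k_i,j_i$ (common length), $M(n,k,j)\equiv\prod_{i=0}^r M(n_i,k_i,j_i)\pmod p$. -}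

module Defs where

open import Data.Nat using (ℕ; zero; suc; _<_; _^_; NonZero)
open import Data.Nat.DivMod using (_/_; _%_)
open import Data.Nat.Properties using (m^n≢0)
open import Data.Nat.Primality using (Prime; prime⇒nonZero)
open import Data.Integer using (ℤ; +_; _+_; _*_; _-_)
open import Data.Integer.Divisibility using (_∣_)
open import Data.Product using (_×_)
open import Relation.Binary.PropositionalEquality using (_≡_)

digit : (p : ℕ) → .{{NonZero p}} → ℕ → ℕ → ℕ
digit p i n = (_/_ n (p ^ i) {{m^n≢0 p i}}) % p

_≡_[mod_] : ℤ → ℤ → ℕ → Set
a ≡ b [mod p ] = (+ p) ∣ (a - b)

sumTo : ℕ → (ℕ → ℤ) → ℤ
sumTo zero    f = f 0
sumTo (suc n) f = sumTo n f + f (suc n)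

prodTo : ℕ → (ℕ → ℤ) → ℤ
prodTo zero    f = f 0
prodTo (suc r) f = prodTo r f * f (suc r)

-- Double Lucas congruences: for every prime p and every common length r+1
-- of base-p expansions of n and k (i.e. n, k < p^(r+1)),
-- L(n,k) ≡ Π_{i=0}^{r} L(n_i,k_i) (mod p).
DoubleLucasCongruences : (ℕ → ℕ → ℤ) → Set
DoubleLucasCongruences L =
  ∀ p (pp : Prime p) (r n k : ℕ) → n < p ^ suc r → k < p ^ suc r →
    L n k ≡ prodTo r (λ i → L (digit p {{prime⇒nonZero pp}} i n)
                              (digit p {{prime⇒nonZero pp}} i k)) [mod p ]

DoubleLucas : (ℕ → ℕ → ℤ) → Set
DoubleLucas L = (∀ n k → n < k → L n k ≡ + 0) × DoubleLucasCongruences L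

TripleLucasCongruences : (ℕ → ℕ → ℕ → ℤ) → Set
TripleLucasCongruences M =
  ∀ p (pp : Prime p) (r n k j : ℕ) →
    n < p ^ suc r → k < p ^ suc r → j < p ^ suc r →
    M n k j ≡ prodTo r (λ i → M (digit p {{prime⇒nonZero pp}} i n)
                                (digit p {{prime⇒nonZero pp}} i k)
                                (digit p {{prime⇒nonZero pp}} i j)) [mod p ]

TripleLucas : (ℕ → ℕ → ℕ → ℤ) → Set
TripleLucas M = (∀ n k j → n < j → M n k j ≡ + 0) × TripleLucasCongruences M

sumL : (ℕ → ℕ → ℕ → ℤ) → ℕ → ℕ → ℤ
sumL M n k = sumTo n (λ j → M n k j)

{-# OPTIONS --safe #-}
module Submission where

-- Write L(n,k) as the sum of M(n,k,j) over all j < p^(r+1), which is allowed because M vanishes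
-- for j > n. Reducing each term by the triple Lucas congruence, the summand becomes a product
-- over i of factors depending only on the i-th digit j_i of j. Since j ↦ (j_0,…,j_r) is a
-- bijection onto {0,…,p-1}^(r+1), the sum of this product factors as the product of the digit
-- sums Σ_{j_i<p} M(n_i,k_i,j_i) = L(n_i,k_i).

open import Defs
open import Data.Nat using (ℕ; zero; suc; _+_; _*_; _∸_; _^_; _≤_; _<_; NonZero; z≤n)
open import Data.Nat.Properties
  using (+-identityʳ; +-comm; +-suc; ≤-refl; m<n⇒m<1+n; m≤n⇒m≤1+n; m≤m+n; m+[n∸m]≡n;
         m∸n+n≡m; *-identityʳ; m^n≢0; ^-distribˡ-+-*)
open import Data.Nat.DivMod
  using (_/_; _%_; +-distrib-/-∣ˡ; m*n/n≡m; m<n⇒m/n≡0; m<n⇒m%n≡m; m%n<n; n/1≡n;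
         [m+kn]%n≡m%n)
open import Data.Nat.Divisibility using (n∣m*n)
open import Data.Nat.Primality using (prime⇒nonZero)
open import Data.Integer using (ℤ; +_)
  renaming (_+_ to _+ᶻ_; _*_ to _*ᶻ_; _-_ to _-ᶻ_)
import Data.Integer.Properties as ℤₚ
open import Data.Integer.Divisibility using (_∣_; divides)
open import Data.Integer.Divisibility.Signed using (∣ᵤ⇒∣; ∣⇒∣ᵤ; ∣m∣n⇒∣m+n)
open import Data.Integer.Tactic.RingSolver using (solve-∀)
import Data.Nat.Tactic.RingSolver as ℕ-Solver
open import Data.Product using (_×_; _,_)
open import Relation.Binary.PropositionalEquality
  using (_≡_; refl; sym; trans; cong; cong₂; subst; subst₂; module ≡-Reasoning)

open ≡-Reasoning

sumBelow : ℕ → (ℕ → ℤ) → ℤ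
sumBelow zero    f = + 0
sumBelow (suc n) f = sumBelow n f +ᶻ f n

sumTo≡sumBelow-suc : ∀ n f → sumTo n f ≡ sumBelow (suc n) f
sumTo≡sumBelow-suc zero    f = sym (ℤₚ.+-identityˡ (f 0))
sumTo≡sumBelow-suc (suc n) f = cong (_+ᶻ f (suc n)) (sumTo≡sumBelow-suc n f)

sumBelow-cong : ∀ n {f g} → (∀ x → x < n → f x ≡ g x) → sumBelow n f ≡ sumBelow n g
sumBelow-cong zero    f≡g = refl
sumBelow-cong (suc n) f≡g =
  cong₂ _+ᶻ_ (sumBelow-cong n (λ x x<n → f≡g x (m<n⇒m<1+n x<n))) (f≡g n ≤-refl)

sumBelow-vanishing : ∀ n {f} → (∀ x → x < n → f x ≡ + 0) → sumBelow n f ≡ + 0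
sumBelow-vanishing zero    f≡0 = refl
sumBelow-vanishing (suc n) f≡0 =
  cong₂ _+ᶻ_ (sumBelow-vanishing n (λ x x<n → f≡0 x (m<n⇒m<1+n x<n))) (f≡0 n ≤-refl)

sumBelow-+ : ∀ m n f → sumBelow (m + n) f ≡ sumBelow m f +ᶻ sumBelow n (λ x → f (m + x))
sumBelow-+ m zero f rewrite +-identityʳ m = sym (ℤₚ.+-identityʳ (sumBelow m f))
sumBelow-+ m (suc n) f rewrite +-suc m n =
  trans (cong (_+ᶻ f (m + n)) (sumBelow-+ m n f)) (ℤₚ.+-assoc (sumBelow m f) _ _)

sumBelow-* : ∀ m n f →
  sumBelow (m * n) f ≡ sumBelow m (λ d → sumBelow n (λ a → f (d * n + a)))
sumBelow-* zero    n f = refl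
sumBelow-* (suc m) n f = begin
  sumBelow (n + m * n) f
    ≡⟨ cong (λ s → sumBelow s f) (+-comm n (m * n)) ⟩
  sumBelow (m * n + n) f
    ≡⟨ sumBelow-+ (m * n) n f ⟩
  sumBelow (m * n) f +ᶻ sumBelow n (λ a → f (m * n + a))
    ≡⟨ cong (_+ᶻ sumBelow n (λ a → f (m * n + a))) (sumBelow-* m n f) ⟩
  sumBelow m (λ d → sumBelow n (λ a → f (d * n + a))) +ᶻ sumBelow n (λ a → f (m * n + a))
    ∎

sumBelow-*ʳ : ∀ n f c → sumBelow n (λ x → f x *ᶻ c) ≡ sumBelow n f *ᶻ c
sumBelow-*ʳ zero    f c = sym (ℤₚ.*-zeroˡ c)
sumBelow-*ʳ (suc n) f c =
  trans (cong (_+ᶻ f n *ᶻ c) (sumBelow-*ʳ n f c))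
        (sym (ℤₚ.*-distribʳ-+ c (sumBelow n f) (f n)))

sumBelow-*ˡ : ∀ n f c → sumBelow n (λ x → c *ᶻ f x) ≡ c *ᶻ sumBelow n f
sumBelow-*ˡ zero    f c = sym (ℤₚ.*-zeroʳ c)
sumBelow-*ˡ (suc n) f c =
  trans (cong (_+ᶻ c *ᶻ f n) (sumBelow-*ˡ n f c))
        (sym (ℤₚ.*-distribˡ-+ c (sumBelow n f) (f n)))

sumTo≡sumBelow : ∀ {n m} f → n < m → (∀ j → n < j → f j ≡ + 0) → sumTo n f ≡ sumBelow m f
sumTo≡sumBelow {n} {m} f n<m f-vanishes = begin
  sumTo n f
    ≡⟨ sumTo≡sumBelow-suc n f ⟩
  sumBelow (suc n) f
    ≡⟨ ℤₚ.+-identityʳ _ ⟨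
  sumBelow (suc n) f +ᶻ + 0
    ≡⟨ cong (sumBelow (suc n) f +ᶻ_) tail≡0 ⟨
  sumBelow (suc n) f +ᶻ sumBelow (m ∸ suc n) (λ x → f (suc n + x))
    ≡⟨ sumBelow-+ (suc n) (m ∸ suc n) f ⟨
  sumBelow (suc n + (m ∸ suc n)) f
    ≡⟨ cong (λ s → sumBelow s f) (m+[n∸m]≡n n<m) ⟩
  sumBelow m f
    ∎
  where
  tail≡0 : sumBelow (m ∸ suc n) (λ x → f (suc n + x)) ≡ + 0
  tail≡0 = sumBelow-vanishing (m ∸ suc n) (λ x _ → f-vanishes (suc n + x) (m≤m+n (suc n) x))

prodTo-cong : ∀ r {f g} → (∀ i → i ≤ r → f i ≡ g i) → prodTo r f ≡ prodTo r g
prodTo-cong zero    f≡g = f≡g 0 z≤n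
prodTo-cong (suc r) f≡g =
  cong₂ _*ᶻ_ (prodTo-cong r (λ i i≤r → f≡g i (m≤n⇒m≤1+n i≤r))) (f≡g (suc r) ≤-refl)

+-cong-mod : ∀ {p} {a b c d : ℤ} →
  a ≡ b [mod p ] → c ≡ d [mod p ] → (a +ᶻ c) ≡ (b +ᶻ d) [mod p ]
+-cong-mod {p} {a} {b} {c} {d} a≡b c≡d =
  subst (+ p ∣_) (sym (rearrange a b c d))
    (∣⇒∣ᵤ {+ p} (∣m∣n⇒∣m+n (∣ᵤ⇒∣ {+ p} {a -ᶻ b} a≡b) (∣ᵤ⇒∣ {+ p} {c -ᶻ d} c≡d)))
  where
  rearrange : ∀ a b c d → (a +ᶻ c) -ᶻ (b +ᶻ d) ≡ (a -ᶻ b) +ᶻ (c -ᶻ d)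
  rearrange = solve-∀

sumBelow-cong-mod : ∀ {p} n {f g} → (∀ x → x < n → f x ≡ g x [mod p ]) →
  sumBelow n f ≡ sumBelow n g [mod p ]
sumBelow-cong-mod zero    f≡g = divides 0 refl
sumBelow-cong-mod (suc n) {f} {g} f≡g =
  +-cong-mod {a = sumBelow n f} {sumBelow n g}
    (sumBelow-cong-mod n (λ x x<n → f≡g x (m<n⇒m<1+n x<n))) (f≡g n ≤-refl)

[m*n+o]/n≡m+o/n : ∀ m n o .{{_ : NonZero n}} → (m * n + o) / n ≡ m + o / n
[m*n+o]/n≡m+o/n m n o = trans (+-distrib-/-∣ˡ o (n∣m*n m)) (cong (_+ o / n) (m*n/n≡m m n))

module _ (p : ℕ) .{{_ : NonZero p}} where

  digit<p : ∀ i n → digit p i n < p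
  digit<p i n = m%n<n _ p

  digit-0 : ∀ {j} → j < p → digit p 0 j ≡ j
  digit-0 {j} j<p = trans (cong (_% p) (n/1≡n j)) (m<n⇒m%n≡m j<p)

  digit-top : ∀ r {d a} → d < p → a < p ^ suc r → digit p (suc r) (d * p ^ suc r + a) ≡ d
  digit-top r {d} {a} d<p a<q = begin
    (d * q + a) / q % p  ≡⟨ cong (_% p) ([m*n+o]/n≡m+o/n d q a) ⟩
    (d + a / q) % p      ≡⟨ cong (λ x → (d + x) % p) (m<n⇒m/n≡0 a<q) ⟩
    (d + 0) % p          ≡⟨ cong (_% p) (+-identityʳ d) ⟩
    d % p                ≡⟨ m<n⇒m%n≡m d<p ⟩
    d                    ∎
    where
    q = p ^ suc r
    instance _ = m^n≢0 p (suc r)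

  digit-below-top : ∀ {i r} d a → i ≤ r → digit p i (d * p ^ suc r + a) ≡ digit p i a
  digit-below-top {i} {r} d a i≤r = begin
    (d * p ^ suc r + a) / q % p      ≡⟨ cong (λ x → (x + a) / q % p) p-multiple ⟩
    (c * p * q + a) / q % p          ≡⟨ cong (_% p) ([m*n+o]/n≡m+o/n (c * p) q a) ⟩
    (c * p + a / q) % p              ≡⟨ cong (_% p) (+-comm (c * p) (a / q)) ⟩
    (a / q + c * p) % p              ≡⟨ [m+kn]%n≡m%n (a / q) c p ⟩
    a / q % p                        ∎
    where
    q = p ^ i
    c = d * p ^ (r ∸ i)
    instance _ = m^n≢0 p i
    rearrange : ∀ d x y z → d * ((x * y) * z) ≡ d * y * x * z
    rearrange = ℕ-Solver.solve-∀
    p-multiple : d * p ^ suc r ≡ c * p * q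
    p-multiple = begin
      d * p ^ suc r                     ≡⟨ cong (λ e → d * p ^ suc e) (m∸n+n≡m i≤r) ⟨
      d * p ^ (suc (r ∸ i) + i)         ≡⟨ cong (d *_) (^-distribˡ-+-* p (suc (r ∸ i)) i) ⟩
      d * (p * p ^ (r ∸ i) * p ^ i)     ≡⟨ rearrange d p (p ^ (r ∸ i)) q ⟩
      c * p * q                         ∎

  sumBelow-prodTo-digits : ∀ r (f : ℕ → ℕ → ℤ) →
    sumBelow (p ^ suc r) (λ j → prodTo r (λ i → f i (digit p i j)))
      ≡ prodTo r (λ i → sumBelow p (f i))
  sumBelow-prodTo-digits zero f = begin
    sumBelow (p * 1) (λ j → f 0 (digit p 0 j))
      ≡⟨ cong (λ n → sumBelow n (λ j → f 0 (digit p 0 j))) (*-identityʳ p) ⟩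
    sumBelow p (λ j → f 0 (digit p 0 j))
      ≡⟨ sumBelow-cong p (λ j j<p → cong (f 0) (digit-0 j<p)) ⟩
    sumBelow p (f 0)
      ∎
  sumBelow-prodTo-digits (suc r) f = begin
    sumBelow (p * q) F
      ≡⟨ sumBelow-* p q F ⟩
    sumBelow p (λ d → sumBelow q (λ a → F (d * q + a)))
      ≡⟨ sumBelow-cong p (λ d d<p → sumBelow-cong q (λ a a<q → split-top d<p a<q)) ⟩
    sumBelow p (λ d → sumBelow q (λ a → G a *ᶻ f (suc r) d))
      ≡⟨ sumBelow-cong p (λ d _ → sumBelow-*ʳ q G (f (suc r) d)) ⟩
    sumBelow p (λ d → sumBelow q G *ᶻ f (suc r) d)
      ≡⟨ sumBelow-*ˡ p (f (suc r)) (sumBelow q G) ⟩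
    sumBelow q G *ᶻ sumBelow p (f (suc r))
      ≡⟨ cong (_*ᶻ sumBelow p (f (suc r))) (sumBelow-prodTo-digits r f) ⟩
    prodTo (suc r) (λ i → sumBelow p (f i))
      ∎
    where
    q = p ^ suc r
    G F : ℕ → ℤ
    G j = prodTo r (λ i → f i (digit p i j))
    F j = prodTo (suc r) (λ i → f i (digit p i j))
    split-top : ∀ {d a} → d < p → a < q → F (d * q + a) ≡ G a *ᶻ f (suc r) d
    split-top {d} {a} d<p a<q =
      cong₂ _*ᶻ_ (prodTo-cong r (λ i i≤r → cong (f i) (digit-below-top d a i≤r)))
                 (cong (f (suc r)) (digit-top r d<p a<q))

tripleLucas⇒doubleLucasCongruences : ∀ M → TripleLucas M → DoubleLucasCongruences (sumL M)
tripleLucas⇒doubleLucasCongruences M (M-vanishes , M-lucas) p pp r n k n<q k<q =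
  subst₂ (λ a b → a ≡ b [mod p ]) (sym L≡full-sum) full-sum-factors
    (sumBelow-cong-mod q (λ j j<q → M-lucas p pp r n k j n<q k<q j<q))
  where
  instance _ = prime⇒nonZero pp
  q = p ^ suc r
  nᵢ kᵢ : ℕ → ℕ
  nᵢ i = digit p i n
  kᵢ i = digit p i k
  L≡full-sum : sumL M n k ≡ sumBelow q (M n k)
  L≡full-sum = sumTo≡sumBelow (M n k) n<q (M-vanishes n k)
  full-sum-factors :
    sumBelow q (λ j → prodTo r (λ i → M (nᵢ i) (kᵢ i) (digit p i j)))
      ≡ prodTo r (λ i → sumL M (nᵢ i) (kᵢ i))
  full-sum-factors = trans (sumBelow-prodTo-digits p r (λ i → M (nᵢ i) (kᵢ i)))
    (prodTo-cong r (λ i _ → sym (sumTo≡sumBelow (M (nᵢ i) (kᵢ i)) (digit<p p i n)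
                                                (M-vanishes (nᵢ i) (kᵢ i)))))

lemma3p3 : (M : ℕ → ℕ → ℕ → ℤ) → TripleLucas M →
    DoubleLucasCongruences (sumL M)
      × ((∀ n k → n < k → sumL M n k ≡ + 0) → DoubleLucas (sumL M))
lemma3p3 M M-lucas = L-lucas , λ L-vanishes → L-vanishes , L-lucas
  where
  L-lucas : DoubleLucasCongruences (sumL M)
  L-lucas = tripleLucas⇒doubleLucasCongruences M M-lucas
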